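{- On the set of reduced linear forms, the relation "$L\longmapsto L'$ if and only if there is a relation from $L$ to $L'$" is a strict total order. Moreover, for linear forms $L_i(m)=a_im+b_i$ ($i=1,2,3$) with $L_1\longmapsto L_2\longmapsto L_3$, $$\mathrm{dist}(L_1,L_2)=[a_1,a_2]\left(\frac{b_2}{a_2}-\frac{b_1}{a_1}\right),\qquad \mathrm{diam}(L_1,L_2,L_3)=[a_1,a_2,a_3]\left(\frac{b_3}{a_3}-\frac{b_1}{a_1}\right),$$ where $[\cdot,\cdot]$ and $[\cdot,\cdot,\cdot]$ denote least common multiples.
   Context: A linear form is $L(m)=am+b$ with $a,b\in\mathbb Z$, $a>0$, viewed as a polynomial in $m$; it is reduced if $\gcd(a,b)=1$. A relation from $L_1$ to $L_2$ is an identity of polynomials $c_2L_2-c_1L_1=r$ with $c_1,c_2,r$ positive integers ($r$ is the relation value). $\mathrm{dist}(L_1,L_2)$ is the minimum relation value $r$ over all relations from $L_1$ to $L_2$. A triangle relation for $(L_1,L_2,L_3)$ consists of positive integers $c_1,c_2,c_3,r_1,r_2$ with $c_2L_2-c_1L_1=r_1$ and $c_3L_3-c_2L_2=r_2$ (so $c_3L_3-c_1L_1=r_1+r_2$); $\mathrm{diam}(L_1,L_2,L_3)$ is the minimum of $r_1+r_2$ over all triangle relations for the triple. -}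

module Defs where

open import Data.Nat as ℕ using (ℕ; _<_; _<?_; NonZero; >-nonZero; _/_)
open import Data.Nat.GCD using (gcd)
open import Data.Nat.LCM using (lcm)
open import Data.Integer as ℤ using (ℤ; +_; ∣_∣)
open import Data.Product using (Σ; _×_)
open import Relation.Nullary.Decidable using (recompute)
open import Relation.Binary.PropositionalEquality using (_≡_)

-- A linear form L(m) = a m + b with a, b integers and a > 0.
-- a is stored as a natural number together with an (irrelevant) proof a > 0,
-- so that two linear forms are equal iff their coefficients are equal.
record LinearForm : Set where
  constructor lf
  field
    a : ℕ
    b : ℤ
    .a-pos : 0 < a
open LinearForm public

a-nonZero : (L : LinearForm) → NonZero (a L)
a-nonZero (lf a _ p) = >-nonZero (recompute (0 <? a) p)

Reduced : LinearForm → Set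
Reduced L = gcd (a L) ∣ b L ∣ ≡ 1

-- A relation from L₁ to L₂: positive integers c₁ c₂ r with the polynomial
-- identity c₂ L₂ − c₁ L₁ = r, i.e. equality of the coefficients of m and of 1.
record Relation (L₁ L₂ : LinearForm) : Set where
  field
    c₁ c₂ r : ℕ
    c₁-pos : 0 < c₁
    c₂-pos : 0 < c₂
    r-pos  : 0 < r
    coeff-m : c₂ ℕ.* a L₂ ≡ c₁ ℕ.* a L₁
    coeff-1 : (+ c₂) ℤ.* b L₂ ℤ.- (+ c₁) ℤ.* b L₁ ≡ + r
open Relation public

_⟼_ : LinearForm → LinearForm → Set
L ⟼ L' = Relation L L'

record ReducedForm : Set where
  constructor rf
  field
    form : LinearForm
    .reduced : Reduced form
open ReducedForm public

_⟼ʳ_ : ReducedForm → ReducedForm → Set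
L ⟼ʳ L' = form L ⟼ form L'

record TriangleRelation (L₁ L₂ L₃ : LinearForm) : Set where
  field
    c₁ c₂ c₃ r₁ r₂ : ℕ
    c₁-pos : 0 < c₁
    c₂-pos : 0 < c₂
    c₃-pos : 0 < c₃
    r₁-pos : 0 < r₁
    r₂-pos : 0 < r₂
    coeff-m₁₂ : c₂ ℕ.* a L₂ ≡ c₁ ℕ.* a L₁
    coeff-1₁₂ : (+ c₂) ℤ.* b L₂ ℤ.- (+ c₁) ℤ.* b L₁ ≡ + r₁
    coeff-m₂₃ : c₃ ℕ.* a L₃ ≡ c₂ ℕ.* a L₂
    coeff-1₂₃ : (+ c₃) ℤ.* b L₃ ℤ.- (+ c₂) ℤ.* b L₂ ≡ + r₂
open TriangleRelation public

IsDist : LinearForm → LinearForm → ℤ → Set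
IsDist L₁ L₂ d =
  Σ (Relation L₁ L₂) (λ R → + r R ≡ d) × ((R : Relation L₁ L₂) → d ℤ.≤ + r R)

IsDiam : LinearForm → LinearForm → LinearForm → ℤ → Set
IsDiam L₁ L₂ L₃ d =
  Σ (TriangleRelation L₁ L₂ L₃) (λ T → + (r₁ T ℕ.+ r₂ T) ≡ d)
  × ((T : TriangleRelation L₁ L₂ L₃) → d ℤ.≤ + (r₁ T ℕ.+ r₂ T))

-- [a₁,a₂] (b₂/a₂ − b₁/a₁) = ([a₁,a₂]/a₂) b₂ − ([a₁,a₂]/a₁) b₁  (exact divisions)
distFormula : LinearForm → LinearForm → ℤ
distFormula L₁ L₂ =
  + ((ℓ / a L₂) {{a-nonZero L₂}}) ℤ.* b L₂ ℤ.- + ((ℓ / a L₁) {{a-nonZero L₁}}) ℤ.* b L₁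
  where ℓ = lcm (a L₁) (a L₂)

diamFormula : LinearForm → LinearForm → LinearForm → ℤ
diamFormula L₁ L₂ L₃ =
  + ((ℓ / a L₃) {{a-nonZero L₃}}) ℤ.* b L₃ ℤ.- + ((ℓ / a L₁) {{a-nonZero L₁}}) ℤ.* b L₁
  where ℓ = lcm (lcm (a L₁) (a L₂)) (a L₃)

{-# OPTIONS --safe #-}
-- Coefficients c₁, c₂ > 0 satisfy the m-part of a relation from L₁ to L₂ iff c₂ a₂ = c₁ a₁,
-- and then a₁ (c₂ b₂ − c₁ b₁) = c₂ det(L₁, L₂) with det(L₁, L₂) = a₁ b₂ − a₂ b₁.
-- Hence L₁ ⟼ L₂ iff det(L₁, L₂) > 0. Since det is antisymmetric, satisfies a cocycle
-- identity, and vanishes on two reduced forms only if they coincide, ⟼ is a strict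
-- total order on reduced forms. The relation value is proportional to c₂, and c₂ a₂ is a
-- common multiple of a₁ and a₂ (and of a₃, for a triangle relation), so the value is
-- least when c₂ a₂ is the least common multiple; that minimal value is the stated formula.
module Submission where

open import Defs
open import Data.Product using (_×_; _,_)
open import Relation.Binary.PropositionalEquality
  using (_≡_; refl; sym; trans; cong; cong₂; subst; isEquivalence; resp₂; module ≡-Reasoning)
open import Relation.Binary.Structures using (IsStrictTotalOrder)
open import Data.Nat as ℕ using (ℕ; _<?_)
import Data.Nat.Properties as ℕP
open import Data.Nat.Divisibility using (_∣_; divides; ∣-trans; ∣-antisym; ∣⇒≤; 0∣⇒≡0; m∣m*n; n∣m*n)
open import Data.Nat.DivMod using (m/n*n≡m; m≥n⇒m/n>0)
open import Data.Nat.GCD using (gcd)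
open import Data.Nat.LCM using (lcm; lcm-least; m∣lcm[m,n]; n∣lcm[m,n])
open import Data.Nat.Coprimality using (gcd≡1⇒coprime; coprime-divisor)
open import Data.Integer as ℤ using (ℤ; +_; +<+; ∣_∣; 0ℤ; _+_; _*_; _-_; -_; _<_; _≤_)
import Data.Integer.Properties as ℤP
open import Data.Integer.Tactic.RingSolver using (solve-∀)
open import Function.Bundles using (_⇔_; mk⇔; module Equivalence)
open import Relation.Binary.Definitions using (tri<; tri≈; tri>; Trichotomous)
open import Relation.Nullary using (¬_)
open import Relation.Nullary.Decidable using (recompute)

open Equivalence using (to; from)

a>0 : (L : LinearForm) → 0 ℕ.< a L
a>0 (lf a _ a-pos) = recompute (0 <? a) a-pos

det : LinearForm → LinearForm → ℤ
det L₁ L₂ = + a L₁ * b L₂ - + a L₂ * b L₁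

value : LinearForm → LinearForm → ℕ → ℕ → ℤ
value L₁ L₂ c₁ c₂ = + c₂ * b L₂ - + c₁ * b L₁

Balanced : LinearForm → LinearForm → ℕ → ℕ → Set
Balanced L₁ L₂ c₁ c₂ = c₂ ℕ.* a L₂ ≡ c₁ ℕ.* a L₁

det-self : ∀ L → det L L ≡ 0ℤ
det-self L = ℤP.+-inverseʳ (+ a L * b L)

det-swap : ∀ L₁ L₂ → det L₂ L₁ ≡ - det L₁ L₂
det-swap L₁ L₂ = swap (+ a L₁) (+ a L₂) (b L₁) (b L₂)
  where
  swap : ∀ a₁ a₂ b₁ b₂ → a₂ * b₁ - a₁ * b₂ ≡ - (a₁ * b₂ - a₂ * b₁)
  swap = solve-∀

det-cocycle : ∀ L₁ L₂ L₃ →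
  + a L₃ * det L₁ L₂ + + a L₁ * det L₂ L₃ ≡ + a L₂ * det L₁ L₃
det-cocycle L₁ L₂ L₃ = cocycle (+ a L₁) (+ a L₂) (+ a L₃) (b L₁) (b L₂) (b L₃)
  where
  cocycle : ∀ a₁ a₂ a₃ b₁ b₂ b₃ →
    a₃ * (a₁ * b₂ - a₂ * b₁) + a₁ * (a₂ * b₃ - a₃ * b₂) ≡ a₂ * (a₁ * b₃ - a₃ * b₁)
  cocycle = solve-∀

value-+ : ∀ L₁ L₂ L₃ c₁ c₂ c₃ →
  value L₁ L₂ c₁ c₂ + value L₂ L₃ c₂ c₃ ≡ value L₁ L₃ c₁ c₃
value-+ L₁ L₂ L₃ c₁ c₂ c₃ = telescope (+ c₁) (+ c₂) (+ c₃) (b L₁) (b L₂) (b L₃)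
  where
  telescope : ∀ c₁ c₂ c₃ b₁ b₂ b₃ →
    (c₂ * b₂ - c₁ * b₁) + (c₃ * b₃ - c₂ * b₂) ≡ c₃ * b₃ - c₁ * b₁
  telescope = solve-∀

a*value≡c*det : ∀ L₁ L₂ c₁ c₂ → Balanced L₁ L₂ c₁ c₂ →
  + a L₁ * value L₁ L₂ c₁ c₂ ≡ + c₂ * det L₁ L₂
a*value≡c*det L₁ L₂ c₁ c₂ bal = begin
  + a₁ * (+ c₂ * b₂ - + c₁ * b₁)          ≡⟨ expand (+ a₁) (+ c₁) (+ c₂) b₁ b₂ ⟩
  + c₂ * (+ a₁ * b₂) - (+ c₁ * + a₁) * b₁ ≡⟨ cong (λ x → + c₂ * (+ a₁ * b₂) - x * b₁) bal' ⟩
  + c₂ * (+ a₁ * b₂) - (+ c₂ * + a₂) * b₁ ≡⟨ collect (+ a₁) (+ a₂) (+ c₂) b₁ b₂ ⟩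
  + c₂ * (+ a₁ * b₂ - + a₂ * b₁)          ∎
  where
  open ≡-Reasoning
  a₁ = a L₁
  a₂ = a L₂
  b₁ = b L₁
  b₂ = b L₂
  bal' : + c₁ * + a₁ ≡ + c₂ * + a₂
  bal' = trans (sym (ℤP.pos-* c₁ a₁)) (trans (cong +_ (sym bal)) (ℤP.pos-* c₂ a₂))
  expand : ∀ a₁ c₁ c₂ b₁ b₂ → a₁ * (c₂ * b₂ - c₁ * b₁) ≡ c₂ * (a₁ * b₂) - (c₁ * a₁) * b₁
  expand = solve-∀
  collect : ∀ a₁ a₂ c₂ b₁ b₂ → c₂ * (a₁ * b₂) - (c₂ * a₂) * b₁ ≡ c₂ * (a₁ * b₂ - a₂ * b₁)
  collect = solve-∀

0<n*i⇔0<i : ∀ {n i} → 0 ℕ.< n → (0ℤ < + n * i ⇔ 0ℤ < i)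
0<n*i⇔0<i {n@(ℕ.suc _)} {i} _ = mk⇔
  (λ 0<ni → ℤP.*-cancelˡ-<-nonNeg (+ n) (subst (_< + n * i) (sym (ℤP.*-zeroʳ (+ n))) 0<ni))
  (λ 0<i → subst (_< + n * i) (ℤP.*-zeroʳ (+ n)) (ℤP.*-monoˡ-<-pos (+ n) 0<i))

0<value⇔0<det : ∀ L₁ L₂ c₁ c₂ → 0 ℕ.< c₂ → Balanced L₁ L₂ c₁ c₂ →
  (0ℤ < value L₁ L₂ c₁ c₂ ⇔ 0ℤ < det L₁ L₂)
0<value⇔0<det L₁ L₂ c₁ c₂ c₂>0 bal = mk⇔
  (λ v>0 → to (0<n*i⇔0<i c₂>0) (subst (0ℤ <_) eq (from (0<n*i⇔0<i (a>0 L₁)) v>0)))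
  (λ d>0 → to (0<n*i⇔0<i (a>0 L₁)) (subst (0ℤ <_) (sym eq) (from (0<n*i⇔0<i c₂>0) d>0)))
  where eq = a*value≡c*det L₁ L₂ c₁ c₂ bal

0<i⇒0<∣i∣ : ∀ {i} → 0ℤ < i → 0 ℕ.< ∣ i ∣
0<i⇒0<∣i∣ (+<+ 0<n) = 0<n

mkRelation : ∀ L₁ L₂ c₁ c₂ → 0 ℕ.< c₁ → 0 ℕ.< c₂ → Balanced L₁ L₂ c₁ c₂ →
  0ℤ < det L₁ L₂ → Relation L₁ L₂
mkRelation L₁ L₂ c₁ c₂ c₁>0 c₂>0 bal d>0 = record
  { c₁ = c₁ ; c₂ = c₂ ; r = ∣ value L₁ L₂ c₁ c₂ ∣
  ; c₁-pos = c₁>0 ; c₂-pos = c₂>0 ; r-pos = 0<i⇒0<∣i∣ v>0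
  ; coeff-m = bal ; coeff-1 = sym (ℤP.0≤i⇒+∣i∣≡i (ℤP.<⇒≤ v>0)) }
  where v>0 = from (0<value⇔0<det L₁ L₂ c₁ c₂ c₂>0 bal) d>0

⟼⇒0<det : ∀ {L₁ L₂} → L₁ ⟼ L₂ → 0ℤ < det L₁ L₂
⟼⇒0<det {L₁} {L₂} R =
  to (0<value⇔0<det L₁ L₂ (c₁ R) (c₂ R) (c₂-pos R) (coeff-m R))
     (subst (0ℤ <_) (sym (coeff-1 R)) (+<+ (r-pos R)))

0<det⇒⟼ : ∀ L₁ L₂ → 0ℤ < det L₁ L₂ → L₁ ⟼ L₂
0<det⇒⟼ L₁ L₂ = mkRelation L₁ L₂ (a L₂) (a L₁) (a>0 L₂) (a>0 L₁) (ℕP.*-comm (a L₁) (a L₂))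

0<det-trans : ∀ L₁ L₂ L₃ → 0ℤ < det L₁ L₂ → 0ℤ < det L₂ L₃ → 0ℤ < det L₁ L₃
0<det-trans L₁ L₂ L₃ d₁₂>0 d₂₃>0 =
  to (0<n*i⇔0<i (a>0 L₂)) (subst (0ℤ <_) (det-cocycle L₁ L₂ L₃)
    (ℤP.+-mono-< (from (0<n*i⇔0<i (a>0 L₃)) d₁₂>0) (from (0<n*i⇔0<i (a>0 L₁)) d₂₃>0)))

⟼-trans : ∀ {L₁ L₂ L₃} → L₁ ⟼ L₂ → L₂ ⟼ L₃ → L₁ ⟼ L₃
⟼-trans {L₁} {L₂} {L₃} R S = 0<det⇒⟼ L₁ L₃ (0<det-trans L₁ L₂ L₃ (⟼⇒0<det R) (⟼⇒0<det S))

coprime-∣ : ∀ {a₁ a₂ n₁ n₂} → gcd a₁ n₁ ≡ 1 → a₁ ℕ.* n₂ ≡ a₂ ℕ.* n₁ → a₁ ∣ a₂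
coprime-∣ {a₁} {a₂} {n₁} {n₂} g≡1 eq = coprime-divisor (gcd≡1⇒coprime g≡1)
  (divides n₂ (trans (ℕP.*-comm n₁ a₂) (trans (sym eq) (ℕP.*-comm a₁ n₂))))

coeffs-≡⇒≡ : ∀ {x y : ReducedForm} → a (form x) ≡ a (form y) → b (form x) ≡ b (form y) → x ≡ y
coeffs-≡⇒≡ {rf (lf _ _ _) _} {rf (lf _ _ _) _} refl refl = refl

det≡0⇒≡ : ∀ (x y : ReducedForm) → det (form x) (form y) ≡ 0ℤ → x ≡ y
det≡0⇒≡ x@(rf L₁@(lf a₁ b₁ _) red₁) y@(rf (lf a₂ b₂ _) red₂) d≡0 = coeffs-≡⇒≡ {x} {y} a₁≡a₂ b₁≡b₂
  where
  cross : + a₁ * b₂ ≡ + a₂ * b₁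
  cross = ℤP.i-j≡0⇒i≡j _ _ d≡0
  cross-abs : a₁ ℕ.* ∣ b₂ ∣ ≡ a₂ ℕ.* ∣ b₁ ∣
  cross-abs = trans (sym (ℤP.abs-* (+ a₁) b₂)) (trans (cong ∣_∣ cross) (ℤP.abs-* (+ a₂) b₁))
  a₁≡a₂ : a₁ ≡ a₂
  a₁≡a₂ = ∣-antisym (coprime-∣ (recompute (gcd a₁ ∣ b₁ ∣ ℕ.≟ 1) red₁) cross-abs)
                    (coprime-∣ (recompute (gcd a₂ ∣ b₂ ∣ ℕ.≟ 1) red₂) (sym cross-abs))
  b₁≡b₂ : b₁ ≡ b₂
  b₁≡b₂ = sym (ℤP.*-cancelˡ-≡ (+ a₁) b₂ b₁ {{a-nonZero L₁}}
                (trans cross (cong (λ n → + n * b₁) (sym a₁≡a₂))))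

⟼⇒det<0 : ∀ {L₁ L₂} → L₂ ⟼ L₁ → det L₁ L₂ < 0ℤ
⟼⇒det<0 {L₁} {L₂} R = ℤP.neg-cancel-< (subst (0ℤ <_) (det-swap L₁ L₂) (⟼⇒0<det R))

det<0⇒⟼ : ∀ L₁ L₂ → det L₁ L₂ < 0ℤ → L₂ ⟼ L₁
det<0⇒⟼ L₁ L₂ d<0 = 0<det⇒⟼ L₂ L₁ (subst (0ℤ <_) (sym (det-swap L₁ L₂)) (ℤP.neg-mono-< d<0))

⟼ʳ-irrefl : ∀ {x y : ReducedForm} → x ≡ y → ¬ (x ⟼ʳ y)
⟼ʳ-irrefl {x} refl R = ℤP.<-irrefl (sym (det-self (form x))) (⟼⇒0<det R)

⟼ʳ-compare : Trichotomous (_≡_ {A = ReducedForm}) _⟼ʳ_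
⟼ʳ-compare x y with ℤP.<-cmp 0ℤ (det (form x) (form y))
... | tri< d>0 _ _ = tri< R (λ x≡y → ⟼ʳ-irrefl x≡y R) (λ R' → ℤP.<-asym d>0 (⟼⇒det<0 R'))
  where R = 0<det⇒⟼ (form x) (form y) d>0
... | tri≈ _ 0≡d _ = tri≈ (λ R → ℤP.<-irrefl 0≡d (⟼⇒0<det R)) (det≡0⇒≡ x y (sym 0≡d))
                          (λ R' → ℤP.<-irrefl (sym 0≡d) (⟼⇒det<0 R'))
... | tri> _ _ d<0 = tri> (λ R → ℤP.<-asym d<0 (⟼⇒0<det R)) (λ x≡y → ⟼ʳ-irrefl (sym x≡y) R') R'
  where R' = det<0⇒⟼ (form x) (form y) d<0

⟼ʳ-isStrictTotalOrder : IsStrictTotalOrder (_≡_ {A = ReducedForm}) _⟼ʳ_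
⟼ʳ-isStrictTotalOrder = record
  { isStrictPartialOrder = record
    { isEquivalence = isEquivalence
    ; irrefl = ⟼ʳ-irrefl
    ; trans = ⟼-trans
    ; <-resp-≈ = resp₂ _⟼ʳ_ }
  ; compare = ⟼ʳ-compare }

value-minimal : ∀ L₁ L₂ q₁ q₂ c₁ c₂ → 0 ℕ.< q₂ → q₂ ℕ.≤ c₂ →
  Balanced L₁ L₂ q₁ q₂ → Balanced L₁ L₂ c₁ c₂ → 0ℤ ≤ value L₁ L₂ q₁ q₂ →
  value L₁ L₂ q₁ q₂ ≤ value L₁ L₂ c₁ c₂
value-minimal L₁ L₂ q₁ q₂ c₁ c₂ q₂>0 q₂≤c₂ balq balc vq≥0 =
  ℤP.*-cancelˡ-≤-pos vq vc (+ q₂) {{ℤ.positive (+<+ q₂>0)}} (begin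
    + q₂ * vq ≤⟨ ℤP.*-monoʳ-≤-nonNeg vq {{ℤ.nonNegative vq≥0}} (ℤ.+≤+ q₂≤c₂) ⟩
    + c₂ * vq ≡⟨ sym proportional ⟩
    + q₂ * vc ∎)
  where
  open ℤP.≤-Reasoning
  vq = value L₁ L₂ q₁ q₂
  vc = value L₁ L₂ c₁ c₂
  exchange : ∀ x y z → x * (y * z) ≡ y * (x * z)
  exchange = solve-∀
  proportional : + q₂ * vc ≡ + c₂ * vq
  proportional = ℤP.*-cancelˡ-≡ (+ a L₁) _ _ {{a-nonZero L₁}} (begin-equality
    + a L₁ * (+ q₂ * vc)       ≡⟨ exchange (+ a L₁) (+ q₂) vc ⟩
    + q₂ * (+ a L₁ * vc)       ≡⟨ cong (+ q₂ *_) (a*value≡c*det L₁ L₂ c₁ c₂ balc) ⟩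
    + q₂ * (+ c₂ * det L₁ L₂)  ≡⟨ exchange (+ q₂) (+ c₂) (det L₁ L₂) ⟩
    + c₂ * (+ q₂ * det L₁ L₂)  ≡⟨ cong (+ c₂ *_) (sym (a*value≡c*det L₁ L₂ q₁ q₂ balq)) ⟩
    + c₂ * (+ a L₁ * vq)       ≡⟨ exchange (+ c₂) (+ a L₁) vq ⟩
    + a L₁ * (+ c₂ * vq)       ∎)

cofactor : LinearForm → ℕ → ℕ
cofactor L ℓ = (ℓ ℕ./ a L) {{a-nonZero L}}

cofactor*a≡ℓ : ∀ L {ℓ} → a L ∣ ℓ → cofactor L ℓ ℕ.* a L ≡ ℓ
cofactor*a≡ℓ L = m/n*n≡m {{a-nonZero L}}

cofactor>0 : ∀ L {ℓ} → 0 ℕ.< ℓ → a L ∣ ℓ → 0 ℕ.< cofactor L ℓ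
cofactor>0 L ℓ>0 a∣ℓ = m≥n⇒m/n>0 {{a-nonZero L}} (∣⇒≤ {{ℕ.>-nonZero ℓ>0}} a∣ℓ)

cofactor≤ : ∀ L {ℓ c} → a L ∣ ℓ → 0 ℕ.< c → ℓ ∣ c ℕ.* a L → cofactor L ℓ ℕ.≤ c
cofactor≤ L {c = c} a∣ℓ c>0 ℓ∣ca = ℕP.*-cancelʳ-≤ _ _ (a L) {{a-nonZero L}}
  (subst (ℕ._≤ c ℕ.* a L) (sym (cofactor*a≡ℓ L a∣ℓ))
    (∣⇒≤ {{ℕP.m*n≢0 c (a L) {{ℕ.>-nonZero c>0}} {{a-nonZero L}}}} ℓ∣ca))

cofactor-balanced : ∀ L₁ L₂ {ℓ} → a L₁ ∣ ℓ → a L₂ ∣ ℓ →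
  Balanced L₁ L₂ (cofactor L₁ ℓ) (cofactor L₂ ℓ)
cofactor-balanced L₁ L₂ a₁∣ℓ a₂∣ℓ = trans (cofactor*a≡ℓ L₂ a₂∣ℓ) (sym (cofactor*a≡ℓ L₁ a₁∣ℓ))

cofactorRelation : ∀ L₁ L₂ {ℓ} → 0 ℕ.< ℓ → a L₁ ∣ ℓ → a L₂ ∣ ℓ →
  0ℤ < det L₁ L₂ → Relation L₁ L₂
cofactorRelation L₁ L₂ {ℓ} ℓ>0 a₁∣ℓ a₂∣ℓ = mkRelation L₁ L₂ (cofactor L₁ ℓ) (cofactor L₂ ℓ)
  (cofactor>0 L₁ ℓ>0 a₁∣ℓ) (cofactor>0 L₂ ℓ>0 a₂∣ℓ) (cofactor-balanced L₁ L₂ a₁∣ℓ a₂∣ℓ)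

cofactor-value-minimal : ∀ L₁ L₂ {ℓ} c₁ c₂ → 0 ℕ.< ℓ → a L₁ ∣ ℓ → a L₂ ∣ ℓ →
  0ℤ < det L₁ L₂ → 0 ℕ.< c₂ → Balanced L₁ L₂ c₁ c₂ → ℓ ∣ c₂ ℕ.* a L₂ →
  value L₁ L₂ (cofactor L₁ ℓ) (cofactor L₂ ℓ) ≤ value L₁ L₂ c₁ c₂
cofactor-value-minimal L₁ L₂ {ℓ} c₁ c₂ ℓ>0 a₁∣ℓ a₂∣ℓ d>0 c₂>0 bal ℓ∣c₂a₂ =
  value-minimal L₁ L₂ q₁ q₂ c₁ c₂ q₂>0 (cofactor≤ L₂ a₂∣ℓ c₂>0 ℓ∣c₂a₂) balq bal
    (ℤP.<⇒≤ (from (0<value⇔0<det L₁ L₂ q₁ q₂ q₂>0 balq) d>0))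
  where
  q₁ = cofactor L₁ ℓ
  q₂ = cofactor L₂ ℓ
  q₂>0 = cofactor>0 L₂ ℓ>0 a₂∣ℓ
  balq = cofactor-balanced L₁ L₂ a₁∣ℓ a₂∣ℓ

lcm>0 : ∀ {m n} → 0 ℕ.< m → 0 ℕ.< n → 0 ℕ.< lcm m n
lcm>0 {m} {n} m>0 n>0 = ℕP.n≢0⇒n>0 λ lcm≡0 → ℕP.<⇒≢ (ℕP.*-mono-< m>0 n>0)
  (sym (0∣⇒≡0 (subst (_∣ m ℕ.* n) lcm≡0 (lcm-least {m} {n} (m∣m*n n) (n∣m*n m)))))

lcm∣balanced : ∀ L₁ L₂ c₁ c₂ → Balanced L₁ L₂ c₁ c₂ → lcm (a L₁) (a L₂) ∣ c₂ ℕ.* a L₂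
lcm∣balanced L₁ L₂ c₁ c₂ bal = lcm-least (divides c₁ bal) (divides c₂ refl)

dist-formula : ∀ L₁ L₂ → L₁ ⟼ L₂ → IsDist L₁ L₂ (distFormula L₁ L₂)
dist-formula L₁ L₂ R = (W , sym (coeff-1 W)) , λ R' →
  subst (distFormula L₁ L₂ ≤_) (coeff-1 R')
    (cofactor-value-minimal L₁ L₂ (c₁ R') (c₂ R') ℓ>0 a₁∣ℓ a₂∣ℓ d>0
      (c₂-pos R') (coeff-m R') (lcm∣balanced L₁ L₂ (c₁ R') (c₂ R') (coeff-m R')))
  where
  ℓ>0 = lcm>0 (a>0 L₁) (a>0 L₂)
  a₁∣ℓ = m∣lcm[m,n] (a L₁) (a L₂)
  a₂∣ℓ = n∣lcm[m,n] (a L₁) (a L₂)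
  d>0 = ⟼⇒0<det R
  W = cofactorRelation L₁ L₂ ℓ>0 a₁∣ℓ a₂∣ℓ d>0

glue : ∀ {L₁ L₂ L₃} (R : Relation L₁ L₂) (S : Relation L₂ L₃) → c₂ R ≡ c₁ S →
  TriangleRelation L₁ L₂ L₃
glue {_} {L₂} {L₃} R S c₂R≡c₁S = record
  { c₁ = c₁ R ; c₂ = c₂ R ; c₃ = c₂ S ; r₁ = r R ; r₂ = r S
  ; c₁-pos = c₁-pos R ; c₂-pos = c₂-pos R ; c₃-pos = c₂-pos S
  ; r₁-pos = r-pos R ; r₂-pos = r-pos S
  ; coeff-m₁₂ = coeff-m R ; coeff-1₁₂ = coeff-1 R
  ; coeff-m₂₃ = trans (coeff-m S) (cong (ℕ._* a L₂) (sym c₂R≡c₁S))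
  ; coeff-1₂₃ = subst (λ c → value L₂ L₃ c (c₂ S) ≡ + r S) (sym c₂R≡c₁S) (coeff-1 S) }

triangle-balanced : ∀ {L₁ L₂ L₃} (T : TriangleRelation L₁ L₂ L₃) → Balanced L₁ L₃ (c₁ T) (c₃ T)
triangle-balanced T = trans (coeff-m₂₃ T) (coeff-m₁₂ T)

triangle-value : ∀ {L₁ L₂ L₃} (T : TriangleRelation L₁ L₂ L₃) →
  value L₁ L₃ (c₁ T) (c₃ T) ≡ + (r₁ T ℕ.+ r₂ T)
triangle-value {L₁} {L₂} {L₃} T = begin
  value L₁ L₃ (c₁ T) (c₃ T)
    ≡⟨ value-+ L₁ L₂ L₃ (c₁ T) (c₂ T) (c₃ T) ⟨
  value L₁ L₂ (c₁ T) (c₂ T) + value L₂ L₃ (c₂ T) (c₃ T)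
    ≡⟨ cong₂ _+_ (coeff-1₁₂ T) (coeff-1₂₃ T) ⟩
  + r₁ T + + r₂ T
    ≡⟨ ℤP.pos-+ (r₁ T) (r₂ T) ⟨
  + (r₁ T ℕ.+ r₂ T)
    ∎
  where open ≡-Reasoning

diam-formula : ∀ L₁ L₂ L₃ → L₁ ⟼ L₂ → L₂ ⟼ L₃ → IsDiam L₁ L₂ L₃ (diamFormula L₁ L₂ L₃)
diam-formula L₁ L₂ L₃ R S = (T , sym (triangle-value T)) , λ T' →
  subst (diamFormula L₁ L₂ L₃ ≤_) (triangle-value T')
    (cofactor-value-minimal L₁ L₃ (c₁ T') (c₃ T') ℓ>0 a₁∣ℓ a₃∣ℓ
      (0<det-trans L₁ L₂ L₃ (⟼⇒0<det R) (⟼⇒0<det S)) (c₃-pos T') (triangle-balanced T')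
      (lcm-least (subst (ℓ₁₂ ∣_) (sym (coeff-m₂₃ T'))
                   (lcm∣balanced L₁ L₂ (c₁ T') (c₂ T') (coeff-m₁₂ T')))
                 (divides (c₃ T') refl)))
  where
  ℓ₁₂ = lcm (a L₁) (a L₂)
  ℓ = lcm ℓ₁₂ (a L₃)
  ℓ>0 = lcm>0 (lcm>0 (a>0 L₁) (a>0 L₂)) (a>0 L₃)
  a₁∣ℓ = ∣-trans (m∣lcm[m,n] (a L₁) (a L₂)) (m∣lcm[m,n] ℓ₁₂ (a L₃))
  a₂∣ℓ = ∣-trans (n∣lcm[m,n] (a L₁) (a L₂)) (m∣lcm[m,n] ℓ₁₂ (a L₃))
  a₃∣ℓ = n∣lcm[m,n] ℓ₁₂ (a L₃)
  T = glue (cofactorRelation L₁ L₂ ℓ>0 a₁∣ℓ a₂∣ℓ (⟼⇒0<det R))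
           (cofactorRelation L₂ L₃ ℓ>0 a₂∣ℓ a₃∣ℓ (⟼⇒0<det S)) refl

lemma1 : IsStrictTotalOrder (_≡_ {A = ReducedForm}) _⟼ʳ_
         × ((L₁ L₂ L₃ : LinearForm) → L₁ ⟼ L₂ → L₂ ⟼ L₃ →
            IsDist L₁ L₂ (distFormula L₁ L₂) × IsDiam L₁ L₂ L₃ (diamFormula L₁ L₂ L₃))
lemma1 = ⟼ʳ-isStrictTotalOrder , λ L₁ L₂ L₃ R S → dist-formula L₁ L₂ R , diam-formula L₁ L₂ L₃ R S
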